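{- Let $P$ be a relative $n$-simplex. Then the first barycentric subdivision $\mathrm{Sd}(P)$ carries a shellable Morse tiling which uses a Morse tile of order zero (resp. of order $n+1$) if and only if $P$ has not been deprived of any ridge (resp. has been deprived of all its ridges), and in that case this tile is unique.
   Context: A relative $n$-simplex $P=\sigma\setminus(\tau_0\cup\dots\cup\tau_k)$ is an $n$-simplex $\sigma$ deprived of some proper faces $\tau_0,\dots,\tau_k$; its ridges are the $(n-1)$-faces of $\sigma$. Its barycentric subdivision is $\mathrm{Sd}(P)=\mathrm{Sd}(\sigma)\setminus(\mathrm{Sd}(\tau_0)\cup\dots\cup\mathrm{Sd}(\tau_k))$, where $\mathrm{Sd}$ of a complex is the complex of chains of its nonempty simplices. A Morse tile of dimension $n$ and order $k$ is an $n$-simplex deprived of $k$ ridges together with possibly one further face of codimension at least two not contained in the removed ridges. A tiling of a relative complex $K\setminus L$ is a partition of $|K|\setminus|L|$ into relative simplices whose underlying simplices lie in $K$ such that for every $d\ge0$ the union of tiles of dimension $>d$ is closed; it is shellable if its tiles can be ordered $T_1,\dots,T_N$ with each $T_1\cup\dots\cup T_p$ closed; it is a Morse tiling if all its tiles are Morse tiles. -}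

module Defs where

open import Data.Nat using (ℕ; zero; suc; _+_; _∸_; _≤_; _<_)
open import Data.Fin using (Fin; toℕ)
open import Data.Fin.Subset using (Subset; _⊂_; ⊤; ∣_∣; Nonempty) renaming (_⊆_ to _⊆ˢ_)
open import Data.List using (List; []; _∷_; length; _++_)
open import Data.Maybe using (Maybe; just; nothing)
open import Data.List.Relation.Unary.All using (All)
open import Data.List.Relation.Unary.Linked using (Linked)
open import Data.List.Relation.Unary.Unique.Propositional using (Unique)
open import Data.List.Relation.Binary.Sublist.Propositional using () renaming (_⊆_ to _⊑_)
open import Data.List.Membership.Propositional using (_∈_)
open import Data.Product using (Σ; ∃; ∃-syntax; _×_; _,_)
open import Data.Unit using () renaming (⊤ to Unit)
open import Relation.Nullary using (¬_)
open import Relation.Binary.PropositionalEquality using (_≡_; _≢_)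

-- A face τ is proper iff τ ≢ ⊤ (the empty face is allowed; it is
-- the unique ridge of a 0-simplex).

Face : ℕ → Set
Face n = Subset (suc n)

-- A relative n-simplex P = σ ∖ (τ₀ ∪ … ∪ τₖ) is given by the list of
-- removed faces, each proper.
record RelSimplex (n : ℕ) : Set where
  field
    removed : List (Face n)
    proper  : All (λ τ → τ ≢ ⊤) removed
open RelSimplex public

IsRidge : (n : ℕ) → Face n → Set
IsRidge n τ = ∣ τ ∣ ≡ n

NoRidgeRemoved : ∀ {n} → RelSimplex n → Set
NoRidgeRemoved {n} P = All (λ τ → ¬ IsRidge n τ) (removed P)

AllRidgesRemoved : ∀ {n} → RelSimplex n → Set
AllRidgesRemoved {n} P = (τ : Face n) → IsRidge n τ → τ ∈ removed P

-- Sd(σ): its simplices are the nonempty chains of nonempty faces of σ,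
-- encoded canonically as strictly ⊂-increasing nonempty lists.
-- Faces of such a simplex are its (nonempty) sublists.

IsSdSimplex : ∀ {n} → List (Face n) → Set
IsSdSimplex c = (c ≢ []) × All Nonempty c × Linked _⊂_ c

InSdFace : ∀ {n} → Face n → List (Face n) → Set
InSdFace τ c = All (λ v → v ⊆ˢ τ) c

-- The (open) cells of Sd(P) = Sd(σ) ∖ ⋃ Sd(τᵢ): simplices of Sd(σ) not
-- lying in any Sd(τᵢ).  The open cells partition |Sd(P)|.
InSdP : ∀ {n} → RelSimplex n → List (Face n) → Set
InSdP P c = IsSdSimplex c × All (λ τ → ¬ InSdFace τ c) (removed P)

-- Morse tiles in Sd(σ): a simplex ρ of Sd(σ) deprived of k distinct
-- ridges (faces of ρ of codimension one) and possibly one further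
-- nonempty face of codimension ≥ 2 not contained in any removed ridge.

ExtraOK : ∀ {n} → List (Face n) → List (List (Face n)) → Maybe (List (Face n)) → Set
ExtraOK ρ rs nothing  = Unit
ExtraOK ρ rs (just μ) =
  (μ ⊑ ρ) × (μ ≢ []) × (length μ + 2 ≤ length ρ) × All (λ r → ¬ (μ ⊑ r)) rs

record MorseTile (n : ℕ) : Set where
  field
    base        : List (Face n)
    baseSimplex : IsSdSimplex base
    ridges      : List (List (Face n))
    ridgesDistinct : Unique ridges
    ridgesOK    : All (λ r → (r ⊑ base) × (suc (length r) ≡ length base)) ridges
    extra       : Maybe (List (Face n))
    extraOK     : ExtraOK base ridges extra
open MorseTile public

order : ∀ {n} → MorseTile n → ℕ
order T = length (ridges T)

dim : ∀ {n} → MorseTile n → ℕ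
dim T = length (base T) ∸ 1

maybeList : ∀ {A : Set} → Maybe A → List A
maybeList nothing  = []
maybeList (just a) = a ∷ []

removedFaces : ∀ {n} → MorseTile n → List (List (Face n))
removedFaces T = ridges T ++ maybeList (extra T)

InTile : ∀ {n} → MorseTile n → List (Face n) → Set
InTile T c = (c ⊑ base T) × (c ≢ []) × All (λ r → ¬ (c ⊑ r)) (removedFaces T)

-- A union S of open cells of Sd(P) is closed in |Sd(P)| iff it contains
-- every face (of a cell in S) which is itself a cell of Sd(P).
ClosedIn : ∀ {n} → RelSimplex n → (List (Face n) → Set) → Set
ClosedIn P S = ∀ c → S c → ∀ e → e ⊑ c → e ≢ [] → InSdP P e → S e

IsMorseTiling : ∀ {n N} → RelSimplex n → (Fin N → MorseTile n) → Set
IsMorseTiling {n} {N} P T =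
    (∀ i c → InTile (T i) c → InSdP P c)
  × (∀ c → InSdP P c → ∃[ i ] InTile (T i) c)
  × (∀ i j c → InTile (T i) c → InTile (T j) c → i ≡ j)
  × (∀ (d : ℕ) → ClosedIn P (λ c → ∃[ i ] (d < dim (T i) × InTile (T i) c)))

IsShelling : ∀ {n N} → RelSimplex n → (Fin N → MorseTile n) → Set
IsShelling P T = ∀ (p : ℕ) → ClosedIn P (λ c → ∃[ i ] (toℕ i < p × InTile (T i) c))

UsesOrder : ∀ {n N} → ℕ → (Fin N → MorseTile n) → Set
UsesOrder k T = ∃[ i ] (order (T i) ≡ k)

UniqueOfOrder : ∀ {n N} → ℕ → (Fin N → MorseTile n) → Set
UniqueOfOrder k T = ∀ i j → order (T i) ≡ k → order (T j) ≡ k → i ≡ j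

-- The maximal simplices of Sd(σ) are the full flags of faces of σ, one for each ordering of
-- the vertices; fix a reference order L of the vertices and index the orderings by their Lehmer
-- codes x. The tile of x is its flag deprived of the ridges opposite its descent faces (the
-- faces after which the next vertex added precedes the previous one in L). Taken in
-- lexicographic order of the codes this is the classical shelling of Sd(σ): every chain of faces
-- lies in the tile of the code recovered greedily from it, and that code is at most the code of
-- any flag containing the chain.
-- For Sd(P) one must further delete, in each flag, the faces lying in some removed τᵢ. They
-- form an initial segment of the flag, so either they are all the faces below σ (when the ridge
-- of σ in the flag is removed), which costs one more removed ridge of the tile, or they are
-- removed as one extra face of codimension at least two, or nothing new has to be removed.
-- Hence a tile has order 0 exactly when its code is the identity and its ridge of σ survives,
-- and order n + 1 exactly when its code is the reversal and that ridge is removed. Choosing L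
-- to begin with a vertex opposite a surviving ridge and to end with one opposite a removed ridge
-- (whenever such exist) turns these into the stated conditions.

module Submission where

open import Defs
open import Data.Nat using (ℕ; zero; suc; _+_; _*_; _∸_; _≤_; _<_; z≤n; s≤s; _!)
open import Data.Nat.Properties
  using (≤-refl; <⇒≤; +-monoʳ-≤; ≤-antisym; <-irrefl; ≮⇒≥; _<?_; suc-injective; m≤n⇒m≤1+n;
         <-≤-trans; ≤-<-trans; +-comm; 0≢1+n; 1+n≢n)
open import Data.Bool.Properties using () renaming (_≟_ to _≟ᵇ_)
open import Data.Fin using (Fin; zero; suc; toℕ; fromℕ; combine; remQuot; punchIn; punchOut)
  renaming (_<_ to _<ᶠ_)
open import Data.Fin.Properties
  using (toℕ-combine; combine-monoˡ-<; remQuot-combine; combine-remQuot; toℕ-injective; toℕ≤pred[n];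
         toℕ-fromℕ; punchInᵢ≢i; punchIn-injective; punchIn-punchOut; any?)
  renaming (_≟_ to _≟ᶠ_; <-cmp to <ᶠ-cmp; <-irrefl to <ᶠ-irrefl)
open import Data.Fin.Permutation
  using (Permutation′; _⟨$⟩ʳ_; _⟨$⟩ˡ_; inverseˡ; inverseʳ; transpose; _∘ₚ_; id)
import Data.Fin.Permutation.Components as PC
open import Data.Fin.Subset using (Subset; ⊤; ⊥; ⁅_⁆; ∁; _∪_; _⊆_; _⊂_; ∣_∣; Nonempty)
  renaming (_∈_ to _∈ˢ_; _∉_ to _∉ˢ_)
open import Data.Fin.Subset.Properties
  using (p⊆p∪q; q⊆p∪q; x∈p∪q⁻; x∈⁅x⁆; x∈⁅y⁆⇒x≡y; ∈⊤; ∉⊥; ⊆⊤; ⊆-antisym; ⊆-refl; ⊆-trans;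
         ⊂-trans; ⊂-irref; x∉p⇒x∈∁p; x∈∁p⇒x∉p; x∉∁p⇒x∈p; _⊆?_; _⊂?_;
         ∣∁p∣≡n∸∣p∣; ∣⁅x⁆∣≡1; ∣⊤∣≡n; p⊂q⇒∣p∣<∣q∣)
  renaming (_∈?_ to _∈ˢ?_)
open import Data.Vec.Properties using (≡-dec)
open import Data.List using (List; []; _∷_; length; filter; map)
open import Data.List.Properties using (filter-all; filter-notAll; length-map)
open import Data.List.Relation.Unary.All as All using (All; []; _∷_)
import Data.List.Relation.Unary.All.Properties as All
open import Data.List.Relation.Unary.Any as Any using (Any; here; there)
open import Data.List.Relation.Unary.AllPairs as AllPairs using (AllPairs; []; _∷_)
open import Data.List.Relation.Unary.Linked as Linked using (Linked; []; [-]; _∷_)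
import Data.List.Relation.Unary.Linked.Properties as Linked
open import Data.List.Relation.Unary.Unique.Propositional using (Unique)
open import Data.List.Relation.Binary.Sublist.Propositional
  using ([]; _∷_; _∷ʳ_) renaming (_⊆_ to _⊑_; ⊆-trans to ⊑-trans)
open import Data.List.Relation.Binary.Sublist.Propositional.Properties
  using (filter-⊆; filter⁺; All-resp-⊆; Any-resp-⊆)
open import Data.List.Membership.Propositional using (_∈_; find; lose)
open import Data.List.Membership.Propositional.Properties using (∈-filter⁺; ∈-filter⁻)
open import Data.Maybe using (Maybe; just; nothing)
open import Data.Product using (Σ; ∃; ∃-syntax; _×_; _,_; proj₁; proj₂)
open import Data.Sum using (_⊎_; inj₁; inj₂; [_,_]′)
open import Data.Empty using (⊥-elim)
open import Function using (_∘_)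
open import Function.Bundles using (_⇔_; mk⇔)
open import Relation.Binary.Definitions using (DecidableEquality; tri<; tri≈; tri>)
open import Relation.Nullary using (¬_; Dec; yes; no; ¬?)
open import Relation.Nullary.Decidable using (decidable-stable)
open import Relation.Unary using (Decidable)
open import Relation.Binary.PropositionalEquality using (_≡_; _≢_; refl; sym; trans; cong; subst)
open Relation.Binary.PropositionalEquality.≡-Reasoning

Unique-map-on : ∀ {A B : Set} {f : A → B} {xs} →
                (∀ {x y} → x ∈ xs → y ∈ xs → f x ≡ f y → x ≡ y) → Unique xs → Unique (map f xs)
Unique-map-on inj [] = []
Unique-map-on inj (x∉xs ∷ u) =
  All.map⁺ (All.tabulate λ y∈ fx≡fy → All.lookup x∉xs y∈ (inj (here refl) (there y∈) fx≡fy))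
  ∷ Unique-map-on (λ x∈ y∈ → inj (there x∈) (there y∈)) u

module _ {A : Set} {P : A → Set} (P? : Decidable P) where

  ⊑-filter : ∀ {c xs} → c ⊑ xs → All P c → c ⊑ filter P? xs
  ⊑-filter {c} c⊑xs all = subst (_⊑ _) (filter-all P? all) (filter⁺ P? P? (λ { refl p → p }) c⊑xs)

  ⊑-filter⁻ : ∀ {c xs} → c ⊑ filter P? xs → All P c
  ⊑-filter⁻ {xs = xs} c⊑ = All-resp-⊆ c⊑ (All.all-filter P? xs)

module _ {A : Set} (_≟_ : DecidableEquality A) where

  open import Data.List.Membership.DecPropositional _≟_ using (_∈?_)

  ridge : List A → A → List A
  ridge ρ v = filter (λ u → ¬? (u ≟ v)) ρ

  ridge⊑ : ∀ ρ v → ridge ρ v ⊑ ρ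
  ridge⊑ ρ v = filter-⊆ (λ u → ¬? (u ≟ v)) ρ

  length-ridge : ∀ {ρ v} → Unique ρ → v ∈ ρ → suc (length (ridge ρ v)) ≡ length ρ
  length-ridge {v ∷ ρ} (v∉ρ ∷ _) (here refl) with v ≟ v
  ... | yes _ = cong (suc ∘ length) (filter-all (λ u → ¬? (u ≟ v)) (All.map (λ v≢u → v≢u ∘ sym) v∉ρ))
  ... | no v≢v = ⊥-elim (v≢v refl)
  length-ridge {x ∷ ρ} {v} (x∉ρ ∷ u) (there v∈ρ) with x ≟ v
  ... | yes refl = ⊥-elim (All.lookup x∉ρ v∈ρ refl)
  ... | no _ = cong suc (length-ridge u v∈ρ)

  ∈⇒⋢ridge : ∀ {ρ c v} → v ∈ c → ¬ c ⊑ ridge ρ v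
  ∈⇒⋢ridge {ρ} v∈c c⊑ = proj₂ (∈-filter⁻ (λ u → ¬? (u ≟ _)) {xs = ρ} (Any-resp-⊆ c⊑ v∈c)) refl

  ⋢ridge⇒∈ : ∀ {ρ c v} → c ⊑ ρ → ¬ c ⊑ ridge ρ v → v ∈ c
  ⋢ridge⇒∈ {c = c} {v} c⊑ρ c⋢ = decidable-stable (v ∈? c)
    λ v∉c → c⋢ (⊑-filter (λ u → ¬? (u ≟ v)) c⊑ρ (All.map (λ v≢u → v≢u ∘ sym) (All.¬Any⇒All¬ c v∉c)))

  ridge-injective : ∀ {ρ v w} → w ∈ ρ → ridge ρ v ≡ ridge ρ w → v ≡ w
  ridge-injective {ρ} {v} {w} w∈ρ eq with v ≟ w
  ... | yes v≡w = v≡w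
  ... | no v≢w = ⊥-elim (proj₂ (∈-filter⁻ (λ u → ¬? (u ≟ w)) {xs = ρ} w∈ridge) refl)
    where
    w∈ridge : w ∈ ridge ρ w
    w∈ridge = subst (w ∈_) eq (∈-filter⁺ (λ u → ¬? (u ≟ v)) w∈ρ (v≢w ∘ sym))

  ⋢ridges⇒⊆ : ∀ {ρ c W} → c ⊑ ρ → All (λ r → ¬ c ⊑ r) (map (ridge ρ) W) → All (_∈ c) W
  ⋢ridges⇒⊆ c⊑ρ = All.map (⋢ridge⇒∈ c⊑ρ) ∘ All.map⁻

  ⊆⇒⋢ridges : ∀ {ρ c W} → All (_∈ c) W → All (λ r → ¬ c ⊑ r) (map (ridge ρ) W)
  ⊆⇒⋢ridges {ρ} = All.map⁺ ∘ All.map (∈⇒⋢ridge {ρ})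

null? : ∀ {A : Set} (xs : List A) → xs ≡ [] ⊎ xs ≢ []
null? [] = inj₁ refl
null? (_ ∷ _) = inj₂ λ ()

⊑[]⇒≡[] : ∀ {A : Set} {xs : List A} → xs ⊑ [] → xs ≡ []
⊑[]⇒≡[] [] = refl

AllPairs-resp-⊑ : ∀ {A : Set} {R : A → A → Set} {xs ys} → xs ⊑ ys → AllPairs R ys → AllPairs R xs
AllPairs-resp-⊑ [] [] = []
AllPairs-resp-⊑ (_ ∷ʳ xs⊑) (_ ∷ rys) = AllPairs-resp-⊑ xs⊑ rys
AllPairs-resp-⊑ (refl ∷ xs⊑) (rx ∷ rys) = All-resp-⊆ xs⊑ rx ∷ AllPairs-resp-⊑ xs⊑ rys

length-filter-misses₂ : ∀ {A : Set} {P : A → Set} (P? : Decidable P) {x y xs} →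
                        x ∈ xs → y ∈ xs → x ≢ y → ¬ P x → ¬ P y → 2 + length (filter P? xs) ≤ length xs
length-filter-misses₂ P? (here refl) (here refl) x≢y _ _ = ⊥-elim (x≢y refl)
length-filter-misses₂ P? {x} {xs = _ ∷ xs} (here refl) (there y∈) _ ¬Px ¬Py with P? x
... | yes Px = ⊥-elim (¬Px Px)
... | no _ = s≤s (filter-notAll P? xs (Any.map (λ { refl → ¬Py }) y∈))
length-filter-misses₂ P? {y = y} {_ ∷ xs} (there x∈) (here refl) _ ¬Px ¬Py with P? y
... | yes Py = ⊥-elim (¬Py Py)
... | no _ = s≤s (filter-notAll P? xs (Any.map (λ { refl → ¬Px }) x∈))
length-filter-misses₂ P? {xs = z ∷ xs} (there x∈) (there y∈) x≢y ¬Px ¬Py with P? z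
... | yes _ = s≤s (length-filter-misses₂ P? x∈ y∈ x≢y ¬Px ¬Py)
... | no _ = m≤n⇒m≤1+n (length-filter-misses₂ P? x∈ y∈ x≢y ¬Px ¬Py)

Linked-⊂-head : ∀ {k} {u : Subset k} {c} → Linked _⊂_ (u ∷ c) → All (u ⊂_) c
Linked-⊂-head [-] = []
Linked-⊂-head (u⊂v ∷ l) = Linked.Linked⇒All ⊂-trans u⊂v l

_≟ˢ_ : ∀ {k} (p q : Subset k) → Dec (p ≡ q)
_≟ˢ_ = ≡-dec _≟ᵇ_

⊆∧≢⇒⊂ : ∀ {k} {p q : Subset k} → p ⊆ q → p ≢ q → p ⊂ q
⊆∧≢⇒⊂ {p = p} {q} p⊆q p≢q with p ⊂? q
... | yes p⊂q = p⊂q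
... | no p⊄q = ⊥-elim (p≢q (⊆-antisym p⊆q q⊆p))
  where
  q⊆p : q ⊆ p
  q⊆p {v} v∈q = decidable-stable (v ∈ˢ? p) λ v∉p → p⊄q (p⊆q , v , v∈q , v∉p)

∈-∪⁅⁆⁻ : ∀ {k} (B : Subset k) a {v} → v ∈ˢ B ∪ ⁅ a ⁆ → v ∈ˢ B ⊎ v ≡ a
∈-∪⁅⁆⁻ B a v∈ with x∈p∪q⁻ B ⁅ a ⁆ v∈
... | inj₁ v∈B = inj₁ v∈B
... | inj₂ v∈a = inj₂ (x∈⁅y⁆⇒x≡y a v∈a)

∈-∪⁅⁆ : ∀ {k} (B : Subset k) a → a ∈ˢ B ∪ ⁅ a ⁆
∈-∪⁅⁆ B a = q⊆p∪q B ⁅ a ⁆ (x∈⁅x⁆ a)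

⊂-∪⁅⁆ : ∀ {k} {B : Subset k} {a} → a ∉ˢ B → B ⊂ B ∪ ⁅ a ⁆
⊂-∪⁅⁆ {B = B} {a} a∉B = p⊆p∪q ⁅ a ⁆ , a , ∈-∪⁅⁆ B a , a∉B

∪⁅⁆⊂ : ∀ {k} {B u : Subset k} {a} → B ⊆ u → a ∈ˢ u → u ≢ B ∪ ⁅ a ⁆ → B ∪ ⁅ a ⁆ ⊂ u
∪⁅⁆⊂ {B = B} {u} {a} B⊆u a∈u u≢ = ⊆∧≢⇒⊂ ∪⊆u (u≢ ∘ sym)
  where
  ∪⊆u : B ∪ ⁅ a ⁆ ⊆ u
  ∪⊆u v∈ with ∈-∪⁅⁆⁻ B a v∈
  ... | inj₁ v∈B = B⊆u v∈B
  ... | inj₂ refl = a∈u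

nonempty⇒⊥⊂ : ∀ {k} {u : Subset k} → Nonempty u → ⊥ ⊂ u
nonempty⇒⊥⊂ (v , v∈u) = (λ w∈⊥ → ⊥-elim (∉⊥ w∈⊥)) , v , v∈u , ∉⊥

⊤⊆⇒≡⊤ : ∀ {k} {τ : Subset k} → ⊤ ⊆ τ → τ ≡ ⊤
⊤⊆⇒≡⊤ ⊤⊆τ = ⊆-antisym ⊆⊤ ⊤⊆τ

∣∁⁅v⁆∣≡n : ∀ {n} (v : Fin (suc n)) → ∣ ∁ ⁅ v ⁆ ∣ ≡ n
∣∁⁅v⁆∣≡n {n} v = trans (∣∁p∣≡n∸∣p∣ ⁅ v ⁆) (cong (suc n ∸_) (∣⁅x⁆∣≡1 v))

⊆∧∣∣≡⇒≡ : ∀ {k} {p q : Subset k} → p ⊆ q → ∣ p ∣ ≡ ∣ q ∣ → p ≡ q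
⊆∧∣∣≡⇒≡ {p = p} {q} p⊆q ∣p∣≡∣q∣ with p ≟ˢ q
... | yes p≡q = p≡q
... | no p≢q = ⊥-elim (<-irrefl ∣p∣≡∣q∣ (p⊂q⇒∣p∣<∣q∣ (⊆∧≢⇒⊂ p⊆q p≢q)))

∉⇒⊆∁⁅⁆ : ∀ {k} {v : Fin k} {τ} → v ∉ˢ τ → τ ⊆ ∁ ⁅ v ⁆
∉⇒⊆∁⁅⁆ {v = v} {τ} v∉τ w∈τ = x∉p⇒x∈∁p λ w∈⁅v⁆ → v∉τ (subst (_∈ˢ τ) (x∈⁅y⁆⇒x≡y v w∈⁅v⁆) w∈τ)

∁⁅⁆-maximal : ∀ {k} {v : Fin k} {τ} → ∁ ⁅ v ⁆ ⊆ τ → τ ≢ ⊤ → τ ≡ ∁ ⁅ v ⁆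
∁⁅⁆-maximal {v = v} {τ} ∁⁅v⁆⊆τ τ≢⊤ = ⊆-antisym (∉⇒⊆∁⁅⁆ v∉τ) ∁⁅v⁆⊆τ
  where
  v∉τ : v ∉ˢ τ
  v∉τ v∈τ = τ≢⊤ (⊤⊆⇒≡⊤ λ {w} _ → decidable-stable (w ∈ˢ? τ) λ w∉τ →
    w∉τ (subst (_∈ˢ τ) (sym (x∈⁅y⁆⇒x≡y v (x∉∁p⇒x∈p λ w∈∁ → w∉τ (∁⁅v⁆⊆τ w∈∁)))) v∈τ))

∣∣≡n⇒≡∁⁅⁆ : ∀ {n} {τ : Subset (suc n)} → ∣ τ ∣ ≡ n → ∃ λ v → τ ≡ ∁ ⁅ v ⁆
∣∣≡n⇒≡∁⁅⁆ {n} {τ} ∣τ∣≡n with any? (λ v → ¬? (v ∈ˢ? τ))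
... | yes (v , v∉τ) = v , ⊆∧∣∣≡⇒≡ (∉⇒⊆∁⁅⁆ v∉τ) (trans ∣τ∣≡n (sym (∣∁⁅v⁆∣≡n v)))
... | no none = ⊥-elim (1+n≢n (trans (sym (trans (cong ∣_∣ τ≡⊤) (∣⊤∣≡n (suc n)))) ∣τ∣≡n))
  where
  τ≡⊤ : τ ≡ ⊤
  τ≡⊤ = ⊤⊆⇒≡⊤ λ {v} _ → decidable-stable (v ∈ˢ? τ) λ v∉τ → none (v , v∉τ)

-- Lehmer codes

punchIn-below : ∀ {m} (d i : Fin (suc m)) → i <ᶠ d →
                ∃ λ i′ → punchIn d i′ ≡ i × toℕ i′ ≡ toℕ i
punchIn-below {suc m} (suc d) zero _ = zero , refl , refl
punchIn-below {suc m} (suc d) (suc i) (s≤s i<d) with punchIn-below d i i<d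
... | i′ , refl , eq = suc i′ , refl , cong suc eq

toℕ-punchIn-below : ∀ {m} (d : Fin (suc m)) (i : Fin m) → toℕ i < toℕ d →
                    toℕ (punchIn d i) ≡ toℕ i
toℕ-punchIn-below (suc d) zero _ = refl
toℕ-punchIn-below (suc d) (suc i) (s≤s i<d) = cong suc (toℕ-punchIn-below d i i<d)

data Lehmer : ℕ → Set where
  [] : Lehmer 0
  _∷_ : ∀ {m} → Fin (suc m) → Lehmer m → Lehmer (suc m)

encode : ∀ {m} → Lehmer m → Fin (m !)
encode [] = zero
encode (d ∷ x) = combine d (encode x)

decode : ∀ {m} → Fin (m !) → Lehmer m
decode {zero} _ = []
decode {suc m} i = proj₁ (remQuot {suc m} (m !) i) ∷ decode (proj₂ (remQuot {suc m} (m !) i))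

decode-encode : ∀ {m} (x : Lehmer m) → decode (encode x) ≡ x
decode-encode [] = refl
decode-encode {suc m} (d ∷ x) =
  trans (cong (λ (d′ , j) → d′ ∷ decode j) (remQuot-combine {suc m} {m !} d (encode x)))
        (cong (d ∷_) (decode-encode x))

encode-decode : ∀ {m} (i : Fin (m !)) → encode (decode {m} i) ≡ i
encode-decode {zero} zero = refl
encode-decode {suc m} i =
  trans (cong (combine (proj₁ (remQuot {suc m} (m !) i)))
              (encode-decode {m} (proj₂ (remQuot {suc m} (m !) i))))
        (combine-remQuot {suc m} (m !) i)

decode-injective : ∀ {m} {i j : Fin (m !)} → decode {m} i ≡ decode j → i ≡ j
decode-injective {m} {i} {j} eq = begin
  i                        ≡⟨ sym (encode-decode {m} i) ⟩
  encode (decode {m} i)    ≡⟨ cong encode eq ⟩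
  encode (decode {m} j)    ≡⟨ encode-decode {m} j ⟩
  j                        ∎

data _≼_ : ∀ {m} → Lehmer m → Lehmer m → Set where
  [] : [] ≼ []
  head< : ∀ {m} {d d′ : Fin (suc m)} {x y} → toℕ d < toℕ d′ → (d ∷ x) ≼ (d′ ∷ y)
  tail≼ : ∀ {m} {d : Fin (suc m)} {x y} → x ≼ y → (d ∷ x) ≼ (d ∷ y)

encode-mono : ∀ {m} {x y : Lehmer m} → x ≼ y → toℕ (encode x) ≤ toℕ (encode y)
encode-mono [] = ≤-refl
encode-mono (head< {x = x} {y} d<d′) = <⇒≤ (combine-monoˡ-< (encode x) (encode y) d<d′)
encode-mono {suc m} (tail≼ {d = d} {x} {y} x≼y)
  rewrite toℕ-combine d (encode x) | toℕ-combine d (encode y) =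
  +-monoʳ-≤ (m ! * toℕ d) (encode-mono x≼y)

-- Both digits index the vertices still available, so d′ < d says that the vertex chosen second
-- precedes the one chosen first.
Descent : ∀ {m} → Fin (suc m) → Lehmer m → Set
Descent d [] = Data.Empty.⊥
Descent d (d′ ∷ _) = toℕ d′ < toℕ d

descent? : ∀ {m} (d : Fin (suc m)) (x : Lehmer m) → Dec (Descent d x)
descent? d [] = no λ ()
descent? d (d′ ∷ _) = toℕ d′ <? toℕ d

descents : ∀ {m} → Lehmer m → ℕ
descents [] = 0
descents (d ∷ x) with descent? d x
... | yes _ = suc (descents x)
... | no _ = descents x

identity : ∀ m → Lehmer m
identity zero = []
identity (suc m) = zero ∷ identity m

reversal : ∀ m → Lehmer m
reversal zero = []
reversal (suc m) = fromℕ m ∷ reversal m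

descents-identity : ∀ m → descents (identity m) ≡ 0
descents-identity zero = refl
descents-identity (suc zero) = refl
descents-identity (suc (suc m)) = descents-identity (suc m)

descents≡0⇒identity : ∀ {m} (x : Lehmer m) → descents x ≡ 0 → x ≡ identity m
descents≡0⇒identity [] _ = refl
descents≡0⇒identity (d ∷ x) h with descent? d x
... | no ¬desc with refl ← descents≡0⇒identity x h = cong (_∷ identity _) (head≡zero d ¬desc)
  where
  head≡zero : ∀ {m} (d : Fin (suc m)) → ¬ Descent d (identity m) → d ≡ zero
  head≡zero zero _ = refl
  head≡zero {suc m} (suc d) ¬desc = ⊥-elim (¬desc (s≤s z≤n))

descents-≤ : ∀ {m} (x : Lehmer (suc m)) → descents x ≤ m
descents-≤ (d ∷ []) = z≤n
descents-≤ {suc m} (d ∷ x) with descent? d x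
... | yes _ = s≤s (descents-≤ x)
... | no _ = m≤n⇒m≤1+n (descents-≤ x)

descents-reversal : ∀ m → descents (reversal (suc m)) ≡ m
descents-reversal zero = refl
descents-reversal (suc m) with descent? (fromℕ (suc m)) (reversal (suc m))
... | yes _ = cong suc (descents-reversal m)
... | no ¬desc = ⊥-elim (¬desc ≤-refl)

descents≡max⇒reversal : ∀ {m} (x : Lehmer (suc m)) → descents x ≡ m → x ≡ reversal (suc m)
descents≡max⇒reversal (zero ∷ []) _ = refl
descents≡max⇒reversal {suc m} (d ∷ x) h with descent? d x
... | no _ = ⊥-elim (<-irrefl h (s≤s (descents-≤ x)))
... | yes desc with refl ← descents≡max⇒reversal x (suc-injective h) =
  cong (_∷ reversal (suc m)) (toℕ-injective (≤-antisym d≤top desc))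
  where
  d≤top : toℕ d ≤ toℕ (fromℕ (suc m))
  d≤top rewrite toℕ-fromℕ (suc m) = toℕ≤pred[n] d

transpose-matchˡ : ∀ {n} (i j : Fin n) → PC.transpose i j i ≡ j
transpose-matchˡ i j with i ≟ᶠ i
... | yes _ = refl
... | no i≢i = ⊥-elim (i≢i refl)

transpose-fix : ∀ {n} {i j k : Fin n} → k ≢ i → k ≢ j → PC.transpose i j k ≡ k
transpose-fix {i = i} {j} {k} k≢i k≢j with k ≟ᶠ i
... | yes k≡i = ⊥-elim (k≢i k≡i)
... | no _ with k ≟ᶠ j
...   | yes k≡j = ⊥-elim (k≢j k≡j)
...   | no _ = refl

distinct⇒zero≢last : ∀ {n} {a b : Fin (suc n)} → a ≢ b → zero ≢ fromℕ n
distinct⇒zero≢last {zero} {zero} {zero} a≢b = ⊥-elim (a≢b refl)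
distinct⇒zero≢last {suc n} _ ()

permutation-with-ends : ∀ {n} {a b : Fin (suc n)} → a ≢ b →
                        ∃ λ (π : Permutation′ (suc n)) → π ⟨$⟩ʳ zero ≡ a × π ⟨$⟩ʳ fromℕ n ≡ b
permutation-with-ends {n} {a} {b} a≢b = transpose (fromℕ n) b′ ∘ₚ transpose zero a , zero↦a , last↦b
  where
  b′ = PC.transpose a zero b
  zero↦a : PC.transpose zero a (PC.transpose (fromℕ n) b′ zero) ≡ a
  zero↦a = trans (cong (PC.transpose zero a) (transpose-fix (distinct⇒zero≢last a≢b) zero≢b′))
                 (transpose-matchˡ zero a)
    where
    zero≢b′ : zero ≢ b′
    zero≢b′ zero≡b′ = a≢b (begin
      a                                            ≡⟨ sym (transpose-matchˡ zero a) ⟩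
      PC.transpose zero a zero                     ≡⟨ cong (PC.transpose zero a) zero≡b′ ⟩
      PC.transpose zero a (PC.transpose a zero b)  ≡⟨ PC.transpose-inverse zero a ⟩
      b                                            ∎)
  last↦b : PC.transpose zero a (PC.transpose (fromℕ n) b′ (fromℕ n)) ≡ b
  last↦b = trans (cong (PC.transpose zero a) (transpose-matchˡ (fromℕ n) b′))
                 (PC.transpose-inverse zero a)

permutation-separating : ∀ {n} {Q : Fin (suc n) → Set} → Decidable Q →
                         ∃ λ (π : Permutation′ (suc n)) →
                           (∃ Q → Q (π ⟨$⟩ʳ zero)) × (∃ (¬_ ∘ Q) → ¬ Q (π ⟨$⟩ʳ fromℕ n))
permutation-separating {n} {Q} Q? with any? Q? | any? (¬? ∘ Q?)
... | yes (a , Qa) | yes (b , ¬Qb) with permutation-with-ends {a = a} {b} (λ { refl → ¬Qb Qa })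
...   | π , π₀≡a , πₙ≡b = π , (λ _ → subst Q (sym π₀≡a) Qa) , (λ _ → subst (¬_ ∘ Q) (sym πₙ≡b) ¬Qb)
permutation-separating {n} {Q} Q? | yes _ | no none¬Q =
  id , (λ _ → decidable-stable (Q? zero) (λ ¬Q₀ → none¬Q (zero , ¬Q₀))) , ⊥-elim ∘ none¬Q
permutation-separating {n} {Q} Q? | no noneQ | _ =
  id , ⊥-elim ∘ noneQ , (λ _ Qₙ → noneQ (fromℕ n , Qₙ))

-- Flags

record Enumerates {k m} (B : Subset k) (L : Fin m → Fin k) : Set where
  field
    avoids    : ∀ i → L i ∉ˢ B
    injective : ∀ {i j} → L i ≡ L j → i ≡ j
    complete  : ∀ v → v ∈ˢ B ⊎ ∃ λ i → L i ≡ v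
open Enumerates

Enumerates-permutation : ∀ {k} (π : Permutation′ k) → Enumerates ⊥ (π ⟨$⟩ʳ_)
Enumerates-permutation π = record
  { avoids = λ _ → ∉⊥
  ; injective = λ πi≡πj → trans (sym (inverseˡ π)) (trans (cong (π ⟨$⟩ˡ_) πi≡πj) (inverseˡ π))
  ; complete = λ v → inj₂ (π ⟨$⟩ˡ v , inverseʳ π)
  }

module _ {k : ℕ} where

  Enumerates-step : ∀ {m} {B : Subset k} {L : Fin (suc m) → Fin k} → Enumerates B L →
                    ∀ d → Enumerates (B ∪ ⁅ L d ⁆) (L ∘ punchIn d)
  Enumerates-step {B = B} {L} e d = record
    { avoids = avoids′ ; injective = punchIn-injective d _ _ ∘ injective e ; complete = complete′ }
    where
    avoids′ : ∀ i → L (punchIn d i) ∉ˢ B ∪ ⁅ L d ⁆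
    avoids′ i v∈ with ∈-∪⁅⁆⁻ B (L d) v∈
    ... | inj₁ v∈B = avoids e _ v∈B
    ... | inj₂ eq = punchInᵢ≢i d i (injective e eq)
    complete′ : ∀ v → v ∈ˢ B ∪ ⁅ L d ⁆ ⊎ ∃ λ i → L (punchIn d i) ≡ v
    complete′ v with complete e v
    ... | inj₁ v∈B = inj₁ (p⊆p∪q ⁅ L d ⁆ v∈B)
    ... | inj₂ (i , refl) with d ≟ᶠ i
    ...   | yes refl = inj₁ (∈-∪⁅⁆ B (L d))
    ...   | no d≢i = inj₂ (punchOut d≢i , cong L (punchIn-punchOut d≢i))

  Enumerates-⊤ : ∀ {B : Subset k} {L : Fin 0 → Fin k} → Enumerates B L → B ≡ ⊤
  Enumerates-⊤ e = ⊤⊆⇒≡⊤ λ {v} _ → [ (λ v∈B → v∈B) , (λ ()) ∘ proj₁ ]′ (complete e v)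

  Enumerates-∁ : ∀ {B : Subset k} {L : Fin 1 → Fin k} → Enumerates B L → B ≡ ∁ ⁅ L zero ⁆
  Enumerates-∁ {B} {L} e = ⊆-antisym (∉⇒⊆∁⁅⁆ (avoids e zero)) ∁⊆B
    where
    ∁⊆B : ∁ ⁅ L zero ⁆ ⊆ B
    ∁⊆B {v} v∈∁ with complete e v
    ... | inj₁ v∈B = v∈B
    ... | inj₂ (zero , refl) = ⊥-elim (x∈∁p⇒x∉p v∈∁ (x∈⁅x⁆ (L zero)))

  Enumerates-⊂ : ∀ {m} {B w : Subset k} {L : Fin m → Fin k} → Enumerates B L → B ⊂ w →
                 ∃ λ i → L i ∈ˢ w
  Enumerates-⊂ e (_ , v , v∈w , v∉B) with complete e v
  ... | inj₁ v∈B = ⊥-elim (v∉B v∈B)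
  ... | inj₂ (i , refl) = i , v∈w

  Enumerates⇒≢⊤ : ∀ {m} {B : Subset k} {L : Fin (suc m) → Fin k} → Enumerates B L → B ≢ ⊤
  Enumerates⇒≢⊤ e refl = avoids e zero ∈⊤

  flag : ∀ {m} → Subset k → (Fin m → Fin k) → Lehmer m → List (Subset k)
  flag B L [] = []
  flag B L (d ∷ x) = B ∪ ⁅ L d ⁆ ∷ flag (B ∪ ⁅ L d ⁆) (L ∘ punchIn d) x

  flag-above : ∀ {m} {B : Subset k} {L : Fin m → Fin k} → Enumerates B L →
               (x : Lehmer m) → All (B ⊂_) (flag B L x)
  flag-above e [] = []
  flag-above e (d ∷ x) = B⊂B′ ∷ All.map (⊂-trans B⊂B′) (flag-above (Enumerates-step e d) x)
    where B⊂B′ = ⊂-∪⁅⁆ (avoids e d)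

  flag-linked : ∀ {m} {B : Subset k} {L : Fin m → Fin k} → Enumerates B L →
                (x : Lehmer m) → Linked _⊂_ (flag B L x)
  flag-linked e [] = []
  flag-linked e (d ∷ []) = [-]
  flag-linked e (d ∷ x@(_ ∷ _)) = All.head (flag-above e′ x) ∷ flag-linked e′ x
    where e′ = Enumerates-step e d

  length-flag : ∀ {m} {B : Subset k} {L : Fin m → Fin k} (x : Lehmer m) → length (flag B L x) ≡ m
  length-flag [] = refl
  length-flag (d ∷ x) = cong suc (length-flag x)

  ⊤∈flag : ∀ {m} {B : Subset k} {L : Fin (suc m) → Fin k} → Enumerates B L →
           (x : Lehmer (suc m)) → ⊤ ∈ flag B L x
  ⊤∈flag e (zero ∷ []) = here (sym (Enumerates-⊤ (Enumerates-step e zero)))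
  ⊤∈flag e (d ∷ x@(_ ∷ _)) = there (⊤∈flag (Enumerates-step e d) x)

  descentFaces : ∀ {m} → Subset k → (Fin m → Fin k) → Lehmer m → List (Subset k)
  descentFaces B L [] = []
  descentFaces B L (d ∷ x) with descent? d x
  ... | yes _ = B ∪ ⁅ L d ⁆ ∷ descentFaces (B ∪ ⁅ L d ⁆) (L ∘ punchIn d) x
  ... | no _ = descentFaces (B ∪ ⁅ L d ⁆) (L ∘ punchIn d) x

  descentFaces⊑flag : ∀ {m} {B : Subset k} {L : Fin m → Fin k} (x : Lehmer m) →
                      descentFaces B L x ⊑ flag B L x
  descentFaces⊑flag [] = []
  descentFaces⊑flag (d ∷ x) with descent? d x
  ... | yes _ = refl ∷ descentFaces⊑flag x
  ... | no _ = _ ∷ʳ descentFaces⊑flag x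

  length-descentFaces : ∀ {m} {B : Subset k} {L : Fin m → Fin k} (x : Lehmer m) →
                        length (descentFaces B L x) ≡ descents x
  length-descentFaces [] = refl
  length-descentFaces (d ∷ x) with descent? d x
  ... | yes _ = cong suc (length-descentFaces x)
  ... | no _ = length-descentFaces x

  descentFaces≢⊤ : ∀ {m} {B : Subset k} {L : Fin m → Fin k} → Enumerates B L →
                   (x : Lehmer m) → All (_≢ ⊤) (descentFaces B L x)
  descentFaces≢⊤ e [] = []
  descentFaces≢⊤ e (d ∷ x) with descent? d x
  descentFaces≢⊤ e (d ∷ x@(_ ∷ _)) | yes _ =
    Enumerates⇒≢⊤ (Enumerates-step e d) ∷ descentFaces≢⊤ (Enumerates-step e d) x
  ... | no _ = descentFaces≢⊤ (Enumerates-step e d) x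

  -- The face just below ⊤ in the flag; for a one-step flag it is B, which is not a member.
  penultimate : ∀ {m} → Subset k → (Fin (suc m) → Fin k) → Lehmer (suc m) → Subset k
  penultimate B L (d ∷ []) = B
  penultimate B L (d ∷ x@(_ ∷ _)) = penultimate (B ∪ ⁅ L d ⁆) (L ∘ punchIn d) x

  lastVertex : ∀ {m} → (Fin (suc m) → Fin k) → Lehmer (suc m) → Fin k
  lastVertex L (d ∷ []) = L d
  lastVertex L (d ∷ x@(_ ∷ _)) = lastVertex (L ∘ punchIn d) x

  penultimate-⊇ : ∀ {m} {B : Subset k} {L : Fin (suc m) → Fin k} (x : Lehmer (suc m)) →
                  B ⊆ penultimate B L x
  penultimate-⊇ (d ∷ []) = ⊆-refl
  penultimate-⊇ {L = L} (d ∷ x@(_ ∷ _)) = penultimate-⊇ x ∘ p⊆p∪q ⁅ L d ⁆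

  flag⊆penultimate : ∀ {m} {B : Subset k} {L : Fin (suc m) → Fin k} → Enumerates B L →
                     (x : Lehmer (suc m)) → All (λ u → u ≡ ⊤ ⊎ u ⊆ penultimate B L x) (flag B L x)
  flag⊆penultimate e (zero ∷ []) = inj₁ (Enumerates-⊤ (Enumerates-step e zero)) ∷ []
  flag⊆penultimate {L = L} e (d ∷ x@(_ ∷ _)) =
    inj₂ (penultimate-⊇ {L = L ∘ punchIn d} x) ∷ flag⊆penultimate (Enumerates-step e d) x

  penultimate≢⊤ : ∀ {m} {B : Subset k} {L : Fin (suc m) → Fin k} → Enumerates B L →
                  (x : Lehmer (suc m)) → penultimate B L x ≢ ⊤
  penultimate≢⊤ e (d ∷ []) = Enumerates⇒≢⊤ e
  penultimate≢⊤ e (d ∷ x@(_ ∷ _)) = penultimate≢⊤ (Enumerates-step e d) x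

  penultimate∈flag : ∀ {m} {B : Subset k} {L : Fin (suc (suc m)) → Fin k} (x : Lehmer (suc (suc m))) →
                     penultimate B L x ∈ flag B L x
  penultimate∈flag (d ∷ _ ∷ []) = here refl
  penultimate∈flag {B = B} {L} (d ∷ x@(_ ∷ _ ∷ _)) =
    there (penultimate∈flag {B = B ∪ ⁅ L d ⁆} {L ∘ punchIn d} x)

  penultimate∈nontrivialFlag : ∀ {m} {B : Subset k} {L : Fin (suc m) → Fin k} → Enumerates B L →
                               (x : Lehmer (suc m)) → ∀ {u} → u ∈ flag B L x → u ≢ ⊤ →
                               penultimate B L x ∈ flag B L x
  penultimate∈nontrivialFlag e (zero ∷ []) (here refl) u≢⊤ =
    ⊥-elim (u≢⊤ (Enumerates-⊤ (Enumerates-step e zero)))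
  penultimate∈nontrivialFlag {B = B} {L} e x@(_ ∷ _ ∷ _) _ _ = penultimate∈flag {B = B} {L} x

  penultimate≡∁lastVertex : ∀ {m} {B : Subset k} {L : Fin (suc m) → Fin k} → Enumerates B L →
                            (x : Lehmer (suc m)) → penultimate B L x ≡ ∁ ⁅ lastVertex L x ⁆
  penultimate≡∁lastVertex e (zero ∷ []) = Enumerates-∁ e
  penultimate≡∁lastVertex e (d ∷ x@(_ ∷ _)) = penultimate≡∁lastVertex (Enumerates-step e d) x

  lastVertex-identity : ∀ {m} (L : Fin (suc m) → Fin k) → lastVertex L (identity (suc m)) ≡ L (fromℕ m)
  lastVertex-identity {zero} L = refl
  lastVertex-identity {suc m} L = lastVertex-identity (L ∘ suc)

  lastVertex-reversal : ∀ {m} (L : Fin (suc m) → Fin k) → lastVertex L (reversal (suc m)) ≡ L zero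
  lastVertex-reversal {zero} L = refl
  lastVertex-reversal {suc m} L = lastVertex-reversal (L ∘ punchIn (fromℕ (suc m)))

-- Recovering a code from a chain

module _ {k : ℕ} where

  firstIn : ∀ {m} → Subset k → (Fin (suc m) → Fin k) → Fin (suc m)
  firstIn {zero} w L = zero
  firstIn {suc m} w L with L zero ∈ˢ? w
  ... | yes _ = zero
  ... | no _ = suc (firstIn w (L ∘ suc))

  firstIn-minimal : ∀ {m} w (L : Fin (suc m) → Fin k) i → i <ᶠ firstIn w L → L i ∉ˢ w
  firstIn-minimal {suc m} w L i i< with L zero ∈ˢ? w
  firstIn-minimal {suc m} w L zero _ | no L₀∉w = L₀∉w
  firstIn-minimal {suc m} w L (suc i) (s≤s i<) | no _ = firstIn-minimal w (L ∘ suc) i i<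

  firstIn-∈ : ∀ {m} w (L : Fin (suc m) → Fin k) → (∃ λ i → L i ∈ˢ w) → L (firstIn w L) ∈ˢ w
  firstIn-∈ {zero} w L (zero , L₀∈w) = L₀∈w
  firstIn-∈ {suc m} w L (i , Li∈w) with L zero ∈ˢ? w
  ... | yes L₀∈w = L₀∈w
  firstIn-∈ {suc m} w L (zero , L₀∈w) | no L₀∉w = ⊥-elim (L₀∉w L₀∈w)
  firstIn-∈ {suc m} w L (suc i , Li∈w) | no _ = firstIn-∈ w (L ∘ suc) (i , Li∈w)

  firstIn-unique : ∀ {m} {w} {L : Fin (suc m) → Fin k} {d} →
                   L d ∈ˢ w → (∀ i → i <ᶠ d → L i ∉ˢ w) → firstIn w L ≡ d
  firstIn-unique {w = w} {L} {d} Ld∈w min with <ᶠ-cmp (firstIn w L) d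
  ... | tri< f<d _ _ = ⊥-elim (min _ f<d (firstIn-∈ w L (d , Ld∈w)))
  ... | tri≈ _ f≡d _ = f≡d
  ... | tri> _ _ d<f = ⊥-elim (firstIn-minimal w L d d<f Ld∈w)

  lowest : List (Subset k) → Subset k
  lowest [] = ⊤
  lowest (u ∷ _) = u

  stripBase : Subset k → List (Subset k) → List (Subset k)
  stripBase B [] = []
  stripBase B (u ∷ c) with u ≟ˢ B
  ... | yes _ = c
  ... | no _ = u ∷ c

  -- Greedy inverse of flag: the lexicographically least code whose flag contains the chain.
  code : ∀ {m} → Subset k → (Fin m → Fin k) → List (Subset k) → Lehmer m
  code {zero} B L c = []
  code {suc m} B L c = d ∷ code (B ∪ ⁅ L d ⁆) (L ∘ punchIn d) (stripBase (B ∪ ⁅ L d ⁆) c)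
    where d = firstIn (lowest c) L

  lowest-above : ∀ {m} {B} {L : Fin (suc m) → Fin k} {c} → Enumerates B L →
                 All (B ⊂_) c → B ⊂ lowest c
  lowest-above e [] = ⊆⊤ , _ , ∈⊤ , avoids e zero
  lowest-above e (B⊂u ∷ _) = B⊂u

  flag⊇head : ∀ {m} {B} {L : Fin (suc m) → Fin k} → Enumerates B L → ∀ d x →
              All (B ∪ ⁅ L d ⁆ ⊆_) (flag B L (d ∷ x))
  flag⊇head e d x = ⊆-refl ∷ All.map proj₁ (flag-above (Enumerates-step e d) x)

  lowest-∋ : ∀ {m} {B} {L : Fin (suc m) → Fin k} {d x c} → Enumerates B L →
             c ⊑ flag B L (d ∷ x) → L d ∈ˢ lowest c
  lowest-∋ {c = []} _ _ = ∈⊤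
  lowest-∋ {B = B} {L} {d} {x} {u ∷ _} e c⊑ =
    All.lookup (flag⊇head e d x) (Any-resp-⊆ c⊑ (here refl)) (∈-∪⁅⁆ B (L d))

  stripBase-⊑ : ∀ {m} {B} {L : Fin (suc m) → Fin k} {d x c} → Enumerates B L → c ⊑ flag B L (d ∷ x) →
                stripBase (B ∪ ⁅ L d ⁆) c ⊑ flag (B ∪ ⁅ L d ⁆) (L ∘ punchIn d) x
  stripBase-⊑ {c = []} _ (_ ∷ʳ c⊑) = c⊑
  stripBase-⊑ {B = B} {L} {d} {x} {u ∷ c} e (_ ∷ʳ c⊑) with u ≟ˢ (B ∪ ⁅ L d ⁆)
  ... | yes refl =
    ⊥-elim (⊂-irref refl (All.lookup (flag-above (Enumerates-step e d) x) (Any-resp-⊆ c⊑ (here refl))))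
  ... | no _ = c⊑
  stripBase-⊑ {B = B} {L} {d} _ (refl ∷ c⊑) with (B ∪ ⁅ L d ⁆) ≟ˢ (B ∪ ⁅ L d ⁆)
  ... | yes _ = c⊑
  ... | no B′≢B′ = ⊥-elim (B′≢B′ refl)

  ∈-stripBase : ∀ {B u c} → u ∈ c → u ≢ B → u ∈ stripBase B c
  ∈-stripBase {B} {c = v ∷ c} u∈ u≢B with v ≟ˢ B | u∈
  ... | yes refl | here refl = ⊥-elim (u≢B refl)
  ... | yes refl | there u∈c = u∈c
  ... | no _ | u∈′ = u∈′

  code-≼ : ∀ {m} {B} {L : Fin m → Fin k} {c} → Enumerates B L → (x : Lehmer m) →
           c ⊑ flag B L x → code B L c ≼ x
  code-≼ e [] _ = []
  code-≼ {L = L} {c} e (d ∷ x) c⊑ with <ᶠ-cmp (firstIn (lowest c) L) d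
  ... | tri< f<d _ _ = head< f<d
  ... | tri≈ _ refl _ = tail≼ (code-≼ (Enumerates-step e d) x (stripBase-⊑ e c⊑))
  ... | tri> _ _ d<f = ⊥-elim (firstIn-minimal _ L d d<f (lowest-∋ e c⊑))

  descentFaces-tail : ∀ {m} {B} {L : Fin (suc m) → Fin k} {P : Subset k → Set} d x →
                      All P (descentFaces B L (d ∷ x)) →
                      All P (descentFaces (B ∪ ⁅ L d ⁆) (L ∘ punchIn d) x)
  descentFaces-tail d x all with descent? d x
  ... | yes _ = All.tail all
  ... | no _ = all

  below-lowest : ∀ {m} {B} {L : Fin (suc m) → Fin k} {d x c} → Enumerates B L →
                 c ⊑ flag B L (d ∷ x) → All (_∈ c) (descentFaces B L (d ∷ x)) →
                 ∀ i → i <ᶠ d → L i ∉ˢ lowest c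
  below-lowest {B = B} {L} {d} e (refl ∷ _) _ i i<d Li∈ with ∈-∪⁅⁆⁻ B (L d) Li∈
  ... | inj₁ Li∈B = avoids e i Li∈B
  ... | inj₂ Li≡Ld = <ᶠ-irrefl (injective e Li≡Ld) i<d
  below-lowest {d = zero} {[]} e (_ ∷ʳ _) D⊆c i ()
  below-lowest {d = d} {x@(d′ ∷ _)} e (_ ∷ʳ c⊑) D⊆c i i<d Li∈ with descent? d x
  ... | yes _ =
    ⊂-irref refl (All.lookup (flag-above (Enumerates-step e d) x) (Any-resp-⊆ c⊑ (All.head D⊆c)))
  ... | no ¬desc with punchIn-below d i i<d
  ...   | i′ , refl , i′≡i =
    below-lowest (Enumerates-step e d) c⊑ D⊆c i′ i′<d′ Li∈
    where
    i′<d′ : i′ <ᶠ d′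
    i′<d′ = subst (_< toℕ d′) (sym i′≡i) (<-≤-trans i<d (≮⇒≥ ¬desc))

  code-unique : ∀ {m} {B} {L : Fin m → Fin k} {c} → Enumerates B L → (x : Lehmer m) →
                c ⊑ flag B L x → All (_∈ c) (descentFaces B L x) → code B L c ≡ x
  code-unique e [] _ _ = refl
  code-unique {B = B} {L} {c} e (d ∷ x) c⊑ D⊆c
    rewrite firstIn-unique (lowest-∋ e c⊑) (below-lowest e c⊑ D⊆c) =
    cong (d ∷_) (code-unique e′ x (stripBase-⊑ e c⊑)
                             (All.zipWith kept (descentFaces-tail d x D⊆c , above)))
    where
    e′ = Enumerates-step e d
    above : All (B ∪ ⁅ L d ⁆ ⊂_) (descentFaces (B ∪ ⁅ L d ⁆) (L ∘ punchIn d) x)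
    above = All-resp-⊆ (descentFaces⊑flag x) (flag-above e′ x)
    kept : ∀ {v} → v ∈ c × B ∪ ⁅ L d ⁆ ⊂ v → v ∈ stripBase (B ∪ ⁅ L d ⁆) c
    kept (v∈c , B′⊂v) = ∈-stripBase v∈c λ v≡B′ → ⊂-irref (sym v≡B′) B′⊂v

  descentFaces-∷ : ∀ {m} {B} {L : Fin (suc m) → Fin k} {P : Subset k → Set} d x →
                   (Descent d x → P (B ∪ ⁅ L d ⁆)) →
                   All P (descentFaces (B ∪ ⁅ L d ⁆) (L ∘ punchIn d) x) →
                   All P (descentFaces B L (d ∷ x))
  descentFaces-∷ d x head tail with descent? d x
  ... | yes desc = head desc ∷ tail
  ... | no _ = tail

  code-no-descent : ∀ {m} {B} {L : Fin (suc m) → Fin k} {c} → Enumerates B L → ∀ d →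
                    All (B ∪ ⁅ L d ⁆ ⊂_) c → (∀ i → i <ᶠ d → L i ∉ˢ lowest c) →
                    ¬ Descent d (code (B ∪ ⁅ L d ⁆) (L ∘ punchIn d) c)
  code-no-descent {zero} _ _ _ _ ()
  code-no-descent {suc m} {L = L} {c} e d above min d′<d =
    min (punchIn d d′) (subst (_< toℕ d) (sym (toℕ-punchIn-below d d′ d′<d)) d′<d)
        (firstIn-∈ (lowest c) (L ∘ punchIn d) (Enumerates-⊂ e′ (lowest-above e′ above)))
    where
    e′ = Enumerates-step e d
    d′ = firstIn (lowest c) (L ∘ punchIn d)

  mutual
    code-covers : ∀ {m} {B} {L : Fin m → Fin k} {c} → Enumerates B L → Linked _⊂_ c → All (B ⊂_) c →
                  c ⊑ flag B L (code B L c) × All (_∈ c) (descentFaces B L (code B L c))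
    code-covers {zero} {c = []} _ _ _ = [] , []
    code-covers {zero} {c = u ∷ _} e _ ((_ , v , _ , v∉B) ∷ _) =
      ⊥-elim (v∉B (subst (v ∈ˢ_) (sym (Enumerates-⊤ e)) ∈⊤))
    code-covers {suc m} {L = L} {c} e l above =
      covers-from e l above (firstIn (lowest c) L)
        (firstIn-∈ (lowest c) L (Enumerates-⊂ e (lowest-above e above)))
        (firstIn-minimal (lowest c) L)

    covers-from : ∀ {m} {B} {L : Fin (suc m) → Fin k} {c} → Enumerates B L → Linked _⊂_ c →
                  All (B ⊂_) c → ∀ d → L d ∈ˢ lowest c → (∀ i → i <ᶠ d → L i ∉ˢ lowest c) →
                  let B′ = B ∪ ⁅ L d ⁆ ; x = code B′ (L ∘ punchIn d) (stripBase B′ c) in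
                  c ⊑ flag B L (d ∷ x) × All (_∈ c) (descentFaces B L (d ∷ x))
    covers-from {B = B} {L} {[]} e _ _ d _ min =
      _ ∷ʳ proj₁ IH ,
      descentFaces-∷ d (code (B ∪ ⁅ L d ⁆) (L ∘ punchIn d) [])
                     (⊥-elim ∘ code-no-descent e d [] min) (proj₂ IH)
      where IH = code-covers (Enumerates-step e d) [] []
    covers-from {B = B} {L} {u ∷ c} e l (B⊂u ∷ _) d Ld∈u min with u ≟ˢ (B ∪ ⁅ L d ⁆)
    ... | yes refl =
      refl ∷ proj₁ IH ,
      descentFaces-∷ d (code u (L ∘ punchIn d) c) (λ _ → here refl) (All.map there (proj₂ IH))
      where IH = code-covers (Enumerates-step e d) (Linked.tail l) (Linked-⊂-head l)
    ... | no u≢B′ =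
      _ ∷ʳ proj₁ IH ,
      descentFaces-∷ d (code (B ∪ ⁅ L d ⁆) (L ∘ punchIn d) (u ∷ c))
                     (⊥-elim ∘ code-no-descent e d above min) (proj₂ IH)
      where
      above = Linked.Linked⇒All ⊂-trans (∪⁅⁆⊂ (proj₁ B⊂u) Ld∈u u≢B′) l
      IH = code-covers (Enumerates-step e d) l above

-- Tiles

module Tiles {n : ℕ}
  (Alive : Face n → Set) (alive? : Decidable Alive)
  (alive-mono : ∀ {u v} → u ⊆ v → Alive u → Alive v) (alive-⊤ : Alive ⊤)
  (L : Fin (suc n) → Fin (suc n)) (enum : Enumerates ⊥ L) where

  chamber : Lehmer (suc n) → List (Face n)
  chamber = flag ⊥ L

  restriction : Lehmer (suc n) → List (Face n)
  restriction = descentFaces ⊥ L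

  σ-ridge : Lehmer (suc n) → Face n
  σ-ridge = penultimate ⊥ L

  deadPart : Lehmer (suc n) → List (Face n)
  deadPart x = filter (¬? ∘ alive?) (chamber x)

  -- The dead faces of a chamber form an initial segment of it. When its ridge of σ is dead they
  -- are all the faces below ⊤; otherwise they are removed as the extra face, unless every cell
  -- containing the restriction is alive anyway.
  data Shape (x : Lehmer (suc n)) : Set where
    topRemoved      : ¬ Alive (σ-ridge x) → Shape x
    deadFaceRemoved : Alive (σ-ridge x) → deadPart x ≢ [] → All (¬_ ∘ Alive) (restriction x) →
                      Shape x
    restrictionOnly : Alive (σ-ridge x) → deadPart x ≡ [] ⊎ Any Alive (restriction x) → Shape x

  shape : ∀ x → Shape x
  shape x with alive? (σ-ridge x)
  ... | no dead = topRemoved dead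
  ... | yes alive with Any.any? alive? (restriction x) | null? (deadPart x)
  ...   | yes some | _ = restrictionOnly alive (inj₂ some)
  ...   | no none | inj₁ empty = restrictionOnly alive (inj₁ empty)
  ...   | no none | inj₂ nonempty = deadFaceRemoved alive nonempty (All.¬Any⇒All¬ _ none)

  chamber-unique : ∀ x → AllPairs _≢_ (chamber x)
  chamber-unique x =
    AllPairs.map (λ u⊂v u≡v → ⊂-irref u≡v u⊂v) (Linked.Linked⇒AllPairs ⊂-trans (flag-linked enum x))

  chamber-simplex : ∀ x → IsSdSimplex (chamber x)
  chamber-simplex x@(_ ∷ _) =
    (λ ()) , All.map (λ (_ , v , v∈u , _) → v , v∈u) (flag-above enum x) , flag-linked enum x

  restriction⊆chamber : ∀ x → All (_∈ chamber x) (restriction x)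
  restriction⊆chamber x = All.tabulate (Any-resp-⊆ (descentFaces⊑flag x))

  removedVertices : ∀ {x} → Shape x → List (Face n)
  removedVertices {x} (topRemoved _) = ⊤ ∷ restriction x
  removedVertices {x} _ = restriction x

  removedVertices⊆chamber : ∀ {x} (s : Shape x) → All (_∈ chamber x) (removedVertices s)
  removedVertices⊆chamber {x} (topRemoved _) = ⊤∈flag enum x ∷ restriction⊆chamber x
  removedVertices⊆chamber {x} (deadFaceRemoved _ _ _) = restriction⊆chamber x
  removedVertices⊆chamber {x} (restrictionOnly _ _) = restriction⊆chamber x

  restriction-unique : ∀ x → AllPairs _≢_ (restriction x)
  restriction-unique x = AllPairs-resp-⊑ (descentFaces⊑flag x) (chamber-unique x)

  removedVertices-unique : ∀ {x} (s : Shape x) → AllPairs _≢_ (removedVertices s)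
  removedVertices-unique {x} (topRemoved _) =
    All.map (λ v≢⊤ ⊤≡v → v≢⊤ (sym ⊤≡v)) (descentFaces≢⊤ enum x) ∷ restriction-unique x
  removedVertices-unique {x} (deadFaceRemoved _ _ _) = restriction-unique x
  removedVertices-unique {x} (restrictionOnly _ _) = restriction-unique x

  ridgeOf : Lehmer (suc n) → Face n → List (Face n)
  ridgeOf x = ridge _≟ˢ_ (chamber x)

  deadMember : ∀ x → deadPart x ≢ [] → ∃ λ u → u ∈ chamber x × ¬ Alive u
  deadMember x nonempty with deadPart x in eq
  ... | [] = ⊥-elim (nonempty refl)
  ... | u ∷ _ = u , ∈-filter⁻ (¬? ∘ alive?) {xs = chamber x} (subst (u ∈_) (sym eq) (here refl))

  deadPart-short : ∀ x → Alive (σ-ridge x) → deadPart x ≢ [] →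
                   length (deadPart x) + 2 ≤ length (chamber x)
  deadPart-short x alive nonempty with deadMember x nonempty
  ... | u , u∈ρ , dead =
    subst (_≤ length (chamber x)) (+-comm 2 (length (deadPart x)))
      (length-filter-misses₂ (¬? ∘ alive?) (penultimate∈nontrivialFlag enum x u∈ρ u≢⊤) (⊤∈flag enum x)
        (penultimate≢⊤ enum x) (λ dead → dead alive) (λ dead → dead alive-⊤))
    where
    u≢⊤ : u ≢ ⊤
    u≢⊤ refl = dead alive-⊤

  extraOf : ∀ {x} → Shape x → Maybe (List (Face n))
  extraOf {x} (deadFaceRemoved _ _ _) = just (deadPart x)
  extraOf _ = nothing

  extraOf-OK : ∀ {x} (s : Shape x) →
               ExtraOK (chamber x) (map (ridgeOf x) (removedVertices s)) (extraOf s)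
  extraOf-OK (topRemoved _) = _
  extraOf-OK {x} (deadFaceRemoved alive nonempty allDead) =
    filter-⊆ (¬? ∘ alive?) (chamber x) , nonempty , deadPart-short x alive nonempty ,
    All.map⁺ (All.zipWith (λ (v∈ρ , dead) → ∈⇒⋢ridge _≟ˢ_ {chamber x} (∈-filter⁺ (¬? ∘ alive?) v∈ρ dead))
                          (restriction⊆chamber x , allDead))
  extraOf-OK (restrictionOnly _ _) = _

  tileOf : ∀ {x} → Shape x → MorseTile n
  tileOf {x} s = record
    { base = chamber x
    ; baseSimplex = chamber-simplex x
    ; ridges = map (ridgeOf x) (removedVertices s)
    ; ridgesDistinct =
        Unique-map-on (λ _ w∈ → ridge-injective _≟ˢ_ (All.lookup (removedVertices⊆chamber s) w∈))
                      (removedVertices-unique s)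
    ; ridgesOK = All.map⁺ (All.map (λ v∈ → ridge⊑ _≟ˢ_ _ _ , length-ridge _≟ˢ_ (chamber-unique x) v∈)
                                   (removedVertices⊆chamber s))
    ; extra = extraOf s
    ; extraOK = extraOf-OK s
    }

  tile : Lehmer (suc n) → MorseTile n
  tile x = tileOf (shape x)

  Cell : Lehmer (suc n) → List (Face n) → Set
  Cell x c = c ⊑ chamber x × c ≢ [] × All (_∈ c) (restriction x) × Any Alive c

  module _ {x : Lehmer (suc n)} {c : List (Face n)} where

    alive⇒⊤∈ : ¬ Alive (σ-ridge x) → c ⊑ chamber x → Any Alive c → ⊤ ∈ c
    alive⇒⊤∈ dead c⊑ any with find any
    ... | u , u∈c , alive with All.lookup (flag⊆penultimate enum x) (Any-resp-⊆ c⊑ u∈c)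
    ...   | inj₁ refl = u∈c
    ...   | inj₂ u⊆ = ⊥-elim (dead (alive-mono u⊆ alive))

    alive⇒⋢deadPart : Any Alive c → ¬ c ⊑ deadPart x
    alive⇒⋢deadPart any c⊑ = All.All¬⇒¬Any (⊑-filter⁻ (¬? ∘ alive?) {xs = chamber x} c⊑) any

    ⋢deadPart⇒alive : c ⊑ chamber x → ¬ c ⊑ deadPart x → Any Alive c
    ⋢deadPart⇒alive c⊑ c⋢ = decidable-stable (Any.any? alive? c)
      λ none → c⋢ (⊑-filter (¬? ∘ alive?) c⊑ (All.¬Any⇒All¬ c none))

    restrictionOnly-alive : deadPart x ≡ [] ⊎ Any Alive (restriction x) →
                            c ⊑ chamber x → c ≢ [] → All (_∈ c) (restriction x) → Any Alive c
    restrictionOnly-alive (inj₁ empty) c⊑ c≢[] _ =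
      ⋢deadPart⇒alive c⊑ (c≢[] ∘ ⊑[]⇒≡[] ∘ subst (c ⊑_) empty)
    restrictionOnly-alive (inj₂ any) _ _ R⊆c with find any
    ... | v , v∈R , alive = lose (All.lookup R⊆c v∈R) alive

    tileOf⇒Cell : (s : Shape x) → InTile (tileOf s) c → Cell x c
    tileOf⇒Cell (topRemoved _) (c⊑ , c≢[] , avoided)
      with ⋢ridges⇒⊆ _≟ˢ_ {W = ⊤ ∷ restriction x} c⊑ (All.++⁻ˡ _ avoided)
    ... | ⊤∈c ∷ R⊆c = c⊑ , c≢[] , R⊆c , lose ⊤∈c alive-⊤
    tileOf⇒Cell (deadFaceRemoved _ _ _) (c⊑ , c≢[] , avoided)
      with All.++⁻ (map (ridgeOf x) (restriction x)) avoided
    ... | avoidsRidges , c⋢A ∷ [] =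
      c⊑ , c≢[] , ⋢ridges⇒⊆ _≟ˢ_ c⊑ avoidsRidges , ⋢deadPart⇒alive c⊑ c⋢A
    tileOf⇒Cell (restrictionOnly _ cond) (c⊑ , c≢[] , avoided) =
      c⊑ , c≢[] , R⊆c , restrictionOnly-alive cond c⊑ c≢[] R⊆c
      where R⊆c = ⋢ridges⇒⊆ _≟ˢ_ c⊑ (All.++⁻ˡ _ avoided)

    Cell⇒tileOf : (s : Shape x) → Cell x c → InTile (tileOf s) c
    Cell⇒tileOf (topRemoved dead) (c⊑ , c≢[] , R⊆c , alive) =
      c⊑ , c≢[] , All.++⁺ (⊆⇒⋢ridges _≟ˢ_ {chamber x} (alive⇒⊤∈ dead c⊑ alive ∷ R⊆c)) []
    Cell⇒tileOf (deadFaceRemoved _ _ _) (c⊑ , c≢[] , R⊆c , alive) =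
      c⊑ , c≢[] , All.++⁺ (⊆⇒⋢ridges _≟ˢ_ {chamber x} R⊆c) (alive⇒⋢deadPart alive ∷ [])
    Cell⇒tileOf (restrictionOnly _ _) (c⊑ , c≢[] , R⊆c , _) =
      c⊑ , c≢[] , All.++⁺ (⊆⇒⋢ridges _≟ˢ_ {chamber x} R⊆c) []

  tile⇒Cell : ∀ {x c} → InTile (tile x) c → Cell x c
  tile⇒Cell {x} = tileOf⇒Cell (shape x)

  Cell⇒tile : ∀ {x c} → Cell x c → InTile (tile x) c
  Cell⇒tile {x} = Cell⇒tileOf (shape x)

  dim-tile : ∀ x → dim (tile x) ≡ n
  dim-tile x = cong (_∸ 1) (length-flag x)

  order-tile-alive : ∀ x → Alive (σ-ridge x) → order (tile x) ≡ descents x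
  order-tile-alive x alive with shape x
  ... | topRemoved dead = ⊥-elim (dead alive)
  ... | deadFaceRemoved _ _ _ = trans (length-map (ridgeOf x) (restriction x)) (length-descentFaces x)
  ... | restrictionOnly _ _ = trans (length-map (ridgeOf x) (restriction x)) (length-descentFaces x)

  order-tile-dead : ∀ x → ¬ Alive (σ-ridge x) → order (tile x) ≡ suc (descents x)
  order-tile-dead x dead with shape x
  ... | topRemoved _ =
    trans (length-map (ridgeOf x) (⊤ ∷ restriction x)) (cong suc (length-descentFaces x))
  ... | deadFaceRemoved alive _ _ = ⊥-elim (dead alive)
  ... | restrictionOnly alive _ = ⊥-elim (dead alive)

  order≡0⇒identity : ∀ x → order (tile x) ≡ 0 → x ≡ identity (suc n) × Alive (σ-ridge x)
  order≡0⇒identity x order≡0 = byAliveness (alive? (σ-ridge x))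
    where
    byAliveness : Dec (Alive (σ-ridge x)) → x ≡ identity (suc n) × Alive (σ-ridge x)
    byAliveness (yes alive) =
      descents≡0⇒identity x (trans (sym (order-tile-alive x alive)) order≡0) , alive
    byAliveness (no dead) = ⊥-elim (0≢1+n (trans (sym order≡0) (order-tile-dead x dead)))

  order≡max⇒reversal : ∀ x → order (tile x) ≡ suc n → x ≡ reversal (suc n) × ¬ Alive (σ-ridge x)
  order≡max⇒reversal x order≡max = byAliveness (alive? (σ-ridge x))
    where
    byAliveness : Dec (Alive (σ-ridge x)) → x ≡ reversal (suc n) × ¬ Alive (σ-ridge x)
    byAliveness (yes alive) =
      ⊥-elim (<-irrefl (trans (sym (order-tile-alive x alive)) order≡max) (s≤s (descents-≤ x)))
    byAliveness (no dead) =
      descents≡max⇒reversal x (suc-injective (trans (sym (order-tile-dead x dead)) order≡max)) , dead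

-- Faces surviving in P

module Surviving {n} (P : RelSimplex n) where

  Alive : Face n → Set
  Alive u = All (λ τ → ¬ u ⊆ τ) (removed P)

  alive? : Decidable Alive
  alive? u = All.all? (λ τ → ¬? (u ⊆? τ)) (removed P)

  alive-mono : ∀ {u v} → u ⊆ v → Alive u → Alive v
  alive-mono u⊆v = All.map λ u⊈τ v⊆τ → u⊈τ (⊆-trans u⊆v v⊆τ)

  alive-⊤ : Alive ⊤
  alive-⊤ = All.map (λ τ≢⊤ → τ≢⊤ ∘ ⊤⊆⇒≡⊤) (proper P)

  dead⇒under-removed : ∀ {u} → ¬ Alive u → Any (u ⊆_) (removed P)
  dead⇒under-removed {u} dead =
    Any.map (decidable-stable (u ⊆? _)) (All.¬All⇒Any¬ (λ τ → ¬? (u ⊆? τ)) (removed P) dead)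

  dead-chain⇒under-removed : ∀ {u c} → Linked _⊂_ (u ∷ c) → All (¬_ ∘ Alive) (u ∷ c) →
                             Any (λ τ → InSdFace τ (u ∷ c)) (removed P)
  dead-chain⇒under-removed [-] (dead ∷ []) = Any.map (_∷ []) (dead⇒under-removed dead)
  dead-chain⇒under-removed (u⊂v ∷ l) (_ ∷ deads) =
    Any.map (λ all → ⊆-trans (proj₁ u⊂v) (All.head all) ∷ all) (dead-chain⇒under-removed l deads)

  InSdP⇒alive : ∀ {c} → InSdP P c → Any Alive c
  InSdP⇒alive {[]} ((c≢[] , _) , _) = ⊥-elim (c≢[] refl)
  InSdP⇒alive {u ∷ c} ((_ , _ , l) , notUnder) =
    decidable-stable (Any.any? alive? (u ∷ c)) λ none →
      All.All¬⇒¬Any notUnder (dead-chain⇒under-removed l (All.¬Any⇒All¬ _ none))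

  alive⇒InSdP : ∀ {c} → IsSdSimplex c → Any Alive c → InSdP P c
  alive⇒InSdP {c} simplex any with find any
  ... | u , u∈c , alive =
    simplex , All.tabulate λ τ∈ under → All.lookup alive τ∈ (All.lookup under u∈c)

  noRidge⇒aliveRidges : NoRidgeRemoved P → ∀ v → Alive (∁ ⁅ v ⁆)
  noRidge⇒aliveRidges noRidge v = All.zipWith notAbove (noRidge , proper P)
    where
    notAbove : ∀ {τ} → ¬ IsRidge n τ × τ ≢ ⊤ → ¬ ∁ ⁅ v ⁆ ⊆ τ
    notAbove (¬ridge , τ≢⊤) ∁⁅v⁆⊆τ =
      ¬ridge (trans (cong ∣_∣ (∁⁅⁆-maximal ∁⁅v⁆⊆τ τ≢⊤)) (∣∁⁅v⁆∣≡n v))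

  aliveRidges⇒noRidge : (∀ v → Alive (∁ ⁅ v ⁆)) → NoRidgeRemoved P
  aliveRidges⇒noRidge alive = All.tabulate λ τ∈ ridge → notRidge τ∈ (∣∣≡n⇒≡∁⁅⁆ ridge)
    where
    notRidge : ∀ {τ} → τ ∈ removed P → ¬ ∃ (λ v → τ ≡ ∁ ⁅ v ⁆)
    notRidge τ∈ (v , refl) = All.lookup (alive v) τ∈ ⊆-refl

  allRidges⇒deadRidges : AllRidgesRemoved P → ∀ v → ¬ Alive (∁ ⁅ v ⁆)
  allRidges⇒deadRidges allRemoved v alive = All.lookup alive (allRemoved _ (∣∁⁅v⁆∣≡n v)) ⊆-refl

  deadRidges⇒allRidges : (∀ v → ¬ Alive (∁ ⁅ v ⁆)) → AllRidgesRemoved P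
  deadRidges⇒allRidges dead τ ridge with ∣∣≡n⇒≡∁⁅⁆ {τ = τ} ridge
  ... | v , refl with find (dead⇒under-removed (dead v))
  ...   | τ′ , τ′∈ , ∁⁅v⁆⊆τ′ =
    subst (_∈ removed P) (∁⁅⁆-maximal ∁⁅v⁆⊆τ′ (All.lookup (proper P) τ′∈)) τ′∈

module Tiling {n} (P : RelSimplex n) where

  open Surviving P

  separation : ∃ λ (π : Permutation′ (suc n)) →
                 (∃[ v ] Alive (∁ ⁅ v ⁆) → Alive (∁ ⁅ π ⟨$⟩ʳ zero ⁆)) ×
                 (∃[ v ] ¬ Alive (∁ ⁅ v ⁆) → ¬ Alive (∁ ⁅ π ⟨$⟩ʳ fromℕ n ⁆))
  separation = permutation-separating (λ v → alive? (∁ ⁅ v ⁆))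

  L : Fin (suc n) → Fin (suc n)
  L = proj₁ separation ⟨$⟩ʳ_

  firstAlive : (∃[ v ] Alive (∁ ⁅ v ⁆)) → Alive (∁ ⁅ L zero ⁆)
  firstAlive = proj₁ (proj₂ separation)

  lastDead : (∃[ v ] ¬ Alive (∁ ⁅ v ⁆)) → ¬ Alive (∁ ⁅ L (fromℕ n) ⁆)
  lastDead = proj₂ (proj₂ separation)

  enum : Enumerates ⊥ L
  enum = Enumerates-permutation (proj₁ separation)

  open Tiles Alive alive? alive-mono alive-⊤ L enum

  T : Fin (suc n !) → MorseTile n
  T = tile ∘ decode

  σ-ridge-identity : σ-ridge (identity (suc n)) ≡ ∁ ⁅ L (fromℕ n) ⁆
  σ-ridge-identity =
    trans (penultimate≡∁lastVertex enum (identity (suc n))) (cong (∁ ∘ ⁅_⁆) (lastVertex-identity L))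

  σ-ridge-reversal : σ-ridge (reversal (suc n)) ≡ ∁ ⁅ L zero ⁆
  σ-ridge-reversal =
    trans (penultimate≡∁lastVertex enum (reversal (suc n))) (cong (∁ ∘ ⁅_⁆) (lastVertex-reversal L))

  InSdP⇒InTile : ∀ {c} → InSdP P c → InTile (T (encode (code ⊥ L c))) c
  InSdP⇒InTile {c} sd@((c≢[] , nonempty , linked) , _) =
    subst (λ x → InTile (tile x) c) (sym (decode-encode _))
          (Cell⇒tile (proj₁ covered , c≢[] , proj₂ covered , InSdP⇒alive sd))
    where
    covered = code-covers enum linked (All.map nonempty⇒⊥⊂ nonempty)

  InTile⇒InSdP : ∀ x {c} → InTile (tile x) c → InSdP P c
  InTile⇒InSdP x t with tile⇒Cell t
  ... | c⊑ , c≢[] , _ , alive = alive⇒InSdP (c≢[] , All-resp-⊆ c⊑ nonempty , linked) alive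
    where
    nonempty = proj₁ (proj₂ (chamber-simplex x))
    linked = Linked.AllPairs⇒Linked
               (AllPairs-resp-⊑ c⊑ (Linked.Linked⇒AllPairs ⊂-trans (flag-linked enum x)))

  code-InTile : ∀ x {c} → InTile (tile x) c → code ⊥ L c ≡ x
  code-InTile x t with tile⇒Cell t
  ... | c⊑ , _ , R⊆c , _ = code-unique enum x c⊑ R⊆c

  dim-T : ∀ i → dim (T i) ≡ n
  dim-T i = dim-tile (decode i)

  isTiling : IsMorseTiling P T
  isTiling = (λ i _ → InTile⇒InSdP (decode i)) , (λ _ sd → _ , InSdP⇒InTile sd) , sameTile , closed
    where
    sameTile : ∀ i j c → InTile (T i) c → InTile (T j) c → i ≡ j
    sameTile i j c tᵢ tⱼ = decode-injective {suc n} (trans (sym (code-InTile _ tᵢ)) (code-InTile _ tⱼ))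
    closed : ∀ d → ClosedIn P (λ c → ∃[ i ] (d < dim (T i) × InTile (T i) c))
    closed d c (i , d<dim , _) e _ _ sd =
      _ , subst (d <_) (trans (dim-T i) (sym (dim-T _))) d<dim , InSdP⇒InTile sd

  isShelling : IsShelling P T
  isShelling p c (i , i<p , tᵢ) e e⊑c _ sd = _ , ≤-<-trans earlier i<p , InSdP⇒InTile sd
    where
    earlier : toℕ (encode (code ⊥ L e)) ≤ toℕ i
    earlier = subst (λ j → toℕ (encode (code ⊥ L e)) ≤ toℕ j) (encode-decode {suc n} i)
                (encode-mono (code-≼ enum (decode i) (⊑-trans e⊑c (proj₁ (tile⇒Cell tᵢ)))))

  usesOrder : ∀ {k} x → order (tile x) ≡ k → UsesOrder k T
  usesOrder {k} x order≡k = encode x , subst (λ y → order (tile y) ≡ k) (sym (decode-encode x)) order≡k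

  uniqueOrder : ∀ {k} x₀ → (∀ x → order (tile x) ≡ k → x ≡ x₀) → UniqueOfOrder k T
  uniqueOrder x₀ determined i j orderᵢ orderⱼ =
    decode-injective {suc n} (trans (determined _ orderᵢ) (sym (determined _ orderⱼ)))

  order0-unique : UniqueOfOrder 0 T
  order0-unique = uniqueOrder (identity (suc n)) (λ x → proj₁ ∘ order≡0⇒identity x)

  orderMax-unique : UniqueOfOrder (suc n) T
  orderMax-unique = uniqueOrder (reversal (suc n)) (λ x → proj₁ ∘ order≡max⇒reversal x)

  order0⇔noRidgeRemoved : UsesOrder 0 T ⇔ NoRidgeRemoved P
  order0⇔noRidgeRemoved = mk⇔ to from
    where
    to : UsesOrder 0 T → NoRidgeRemoved P
    to (i , order≡0) with order≡0⇒identity (decode i) order≡0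
    ... | isIdentity , alive = aliveRidges⇒noRidge λ v → decidable-stable (alive? _) λ dead →
      lastDead (v , dead) (subst Alive σ-ridge-identity (subst (Alive ∘ σ-ridge) isIdentity alive))
    from : NoRidgeRemoved P → UsesOrder 0 T
    from noRidge =
      usesOrder (identity (suc n)) (trans (order-tile-alive _ alive) (descents-identity (suc n)))
      where alive = subst Alive (sym σ-ridge-identity) (noRidge⇒aliveRidges noRidge _)

  orderMax⇔allRidgesRemoved : UsesOrder (suc n) T ⇔ AllRidgesRemoved P
  orderMax⇔allRidgesRemoved = mk⇔ to from
    where
    to : UsesOrder (suc n) T → AllRidgesRemoved P
    to (i , order≡max) with order≡max⇒reversal (decode i) order≡max
    ... | isReversal , dead = deadRidges⇒allRidges λ v alive →
      dead (subst (Alive ∘ σ-ridge) (sym isReversal)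
                  (subst Alive (sym σ-ridge-reversal) (firstAlive (v , alive))))
    from : AllRidgesRemoved P → UsesOrder (suc n) T
    from allRemoved =
      usesOrder (reversal (suc n)) (trans (order-tile-dead _ dead) (cong suc (descents-reversal n)))
      where dead = subst (¬_ ∘ Alive) (sym σ-ridge-reversal) (allRidges⇒deadRidges allRemoved _)

proposition3p3 : (n : ℕ) (P : RelSimplex n) →
    ∃[ N ] Σ (Fin N → MorseTile n) λ T →
      IsMorseTiling P T × IsShelling P T
      × (UsesOrder 0 T ⇔ NoRidgeRemoved P) × (UsesOrder 0 T → UniqueOfOrder 0 T)
      × (UsesOrder (suc n) T ⇔ AllRidgesRemoved P) × (UsesOrder (suc n) T → UniqueOfOrder (suc n) T)
proposition3p3 n P =
  suc n ! , T , isTiling , isShelling ,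
  order0⇔noRidgeRemoved , (λ _ → order0-unique) , orderMax⇔allRidgesRemoved , (λ _ → orderMax-unique)
  where open Tiling P
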